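{- Let $k\geq 3$, let $H$ be a $k$-graph with weighting function $\mathbf{w}:V(H)\cup E(H)\to\mathbb{C}$, and let $e\in E(H)$ contain at least two vertices of degree one. If $\lambda$ is an eigenvalue of $\mathcal{A}(H\setminus e,\mathbf{w})$, then $\lambda$ is an eigenvalue of $\mathcal{A}(H,\mathbf{w})$.
   Context: A $k$-graph $H$ consists of a finite vertex set $V(H)$ and a set $E(H)$ of $k$-element subsets of $V(H)$; the degree of $v$ is the number of edges containing it. $H\setminus e$ is the $k$-graph obtained from $H$ by deleting the edge $e$ together with the vertices that become isolated; $\mathcal{A}(H\setminus e,\mathbf{w})$ uses the restriction of $\mathbf{w}$. For $V(H)=\{v_1,\dots,v_n\}$, the adjacency tensor $\mathcal{A}(H,\mathbf{w})=(a_{i_1\cdots i_k})$ has $a_{i\cdots i}=\mathbf{w}(v_i)$, $a_{i_1\cdots i_k}=\mathbf{w}(e)/(k-1)!$ if $\{v_{i_1},\dots,v_{i_k}\}=e\in E(H)$, and $0$ otherwise. $\lambda\in\mathbb{C}$ is an eigenvalue of a tensor $\mathcal{A}$ of order $k$ and dimension $n$ if there is nonzero $\mathbf{x}\in\mathbb{C}^n$ with $\sum_{i_2,\dots,i_k}a_{ii_2\cdots i_k}\mathbf{x}_{i_2}\cdots\mathbf{x}_{i_k}=\lambda\mathbf{x}_i^{k-1}$ for all $i$. -}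

module Defs where

open import Level using (Level; _⊔_)
open import Data.Nat using (ℕ; zero; suc; pred; _!; _≡ᵇ_)
open import Data.Bool using (Bool; true; false; _∧_; not; if_then_else_)
open import Data.Fin using (Fin)
open import Data.Fin.Subset using (Subset; ⁅_⁆; _∪_; ⊥; _∈_; _⊆_; ∣_∣)
open import Data.Fin.Subset.Properties using (_∈?_)
open import Data.Fin.Properties using () renaming (_≟_ to _≟ᶠ_)
open import Data.Vec using (Vec; []; _∷_; tabulate; lookup)
open import Data.Vec.Properties using (≡-dec)
import Data.Bool.Properties as BoolP
open import Data.List using (List; []; _∷_; map; concatMap; allFin; length; filterᵇ; foldr)
open import Data.List.Relation.Unary.Unique.Propositional using (Unique)
open import Data.List.Membership.Propositional using () renaming (_∈_ to _∈ᴸ_)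
open import Data.Product using (Σ; ∃; _×_; _,_)
open import Relation.Nullary using (¬_; Dec; yes; no)
open import Relation.Nullary.Decidable using (⌊_⌋)
open import Relation.Binary.Definitions using (DecidableEquality)
open import Relation.Binary.PropositionalEquality using (_≡_)
open import Algebra.Bundles using (CommutativeRing)

_≟ˢ_ : ∀ {n} → DecidableEquality (Subset n)
_≟ˢ_ = ≡-dec BoolP._≟_

_∈ᴸ?_ : ∀ {n} → Subset n → List (Subset n) → Bool
s ∈ᴸ? [] = false
s ∈ᴸ? (f ∷ fs) = if ⌊ s ≟ˢ f ⌋ then true else (s ∈ᴸ? fs)

setOf : ∀ {n p} → Vec (Fin n) p → Subset n
setOf [] = ⊥
setOf (i ∷ t) = ⁅ i ⁆ ∪ setOf t

allEq : ∀ {n p} → Fin n → Vec (Fin n) p → Bool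
allEq i [] = true
allEq i (j ∷ t) = ⌊ i ≟ᶠ j ⌋ ∧ allEq i t

allIn : ∀ {n p} → Subset n → Vec (Fin n) p → Bool
allIn V [] = true
allIn V (j ∷ t) = ⌊ j ∈? V ⌋ ∧ allIn V t

allVecs : ∀ p n → List (Vec (Fin n) p)
allVecs zero n = [] ∷ []
allVecs (suc p) n = concatMap (λ i → map (i ∷_) (allVecs p n)) (allFin n)

tuplesIn : ∀ {n} p → Subset n → List (Vec (Fin n) p)
tuplesIn {n} p V = filterᵇ (allIn V) (allVecs p n)

-- k-graphs.  The vertex set V(H) is a finite set, given as a subset V
-- of an ambient universe Fin n; edges are k-element subsets of V(H),
-- listed without repetition.

record KGraph (k n : ℕ) : Set where
  field
    V      : Subset n
    E      : List (Subset n)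
    E-uniq : Unique E
    E-card : ∀ {f} → f ∈ᴸ E → ∣ f ∣ ≡ k
    E-sub  : ∀ {f} → f ∈ᴸ E → f ⊆ V

open KGraph public

degIn : ∀ {n} → List (Subset n) → Fin n → ℕ
degIn E v = length (filterᵇ (λ f → ⌊ v ∈? f ⌋) E)

degree : ∀ {k n} → KGraph k n → Fin n → ℕ
degree H v = degIn (E H) v

-- H ∖ e : delete the edge e, together with the vertices that become
-- isolated (vertices of e with degree 0 after the deletion).
edgesDel : ∀ {k n} → KGraph k n → Subset n → List (Subset n)
edgesDel H e = filterᵇ (λ f → not ⌊ f ≟ˢ e ⌋) (E H)

verticesDel : ∀ {k n} → KGraph k n → Subset n → Subset n
verticesDel H e =
  tabulate (λ v → lookup (V H) v ∧ not (⌊ v ∈? e ⌋ ∧ (degIn (edgesDel H e) v ≡ᵇ 0)))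

module _ {c ℓ} (R : CommutativeRing c ℓ) where
  open CommutativeRing R

  record Weighting (n : ℕ) : Set c where
    field
      wV : Fin n → Carrier
      wE : Subset n → Carrier

  sumL : ∀ {a} {A : Set a} → List A → (A → Carrier) → Carrier
  sumL xs f = foldr (λ a r → f a + r) 0# xs

  prodV : ∀ {n p} → Vec (Fin n) p → (Fin n → Carrier) → Carrier
  prodV [] x = 1#
  prodV (i ∷ t) x = x i * prodV t x

  pow : Carrier → ℕ → Carrier
  pow a zero = 1#
  pow a (suc m) = a * pow a m

  natR : ℕ → Carrier
  natR zero = 0#
  natR (suc m) = 1# + natR m

  -- an order-k tensor with index set V ⊆ Fin n, entry a_{i i_2 ... i_k}
  -- given as T i (i_2 ∷ ... ∷ i_k ∷ [])
  Tensor : ℕ → ℕ → Set c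
  Tensor k n = Fin n → Vec (Fin n) (pred k) → Carrier

  -- adjacency tensor A((V,E), w) of order k; inv plays the role of
  -- 1/(k-1)! (it is required below to be the inverse of (k-1)!)
  adjTensor : ∀ {n} k → List (Subset n) → Weighting n → Carrier → Tensor k n
  adjTensor k E w inv i t =
    if allEq i t then Weighting.wV w i
    else (if setOf (i ∷ t) ∈ᴸ? E then Weighting.wE w (setOf (i ∷ t)) * inv else 0#)

  IsEigenvalue : ∀ {n} k → Subset n → Tensor k n → Carrier → Set (c ⊔ ℓ)
  IsEigenvalue {n} k V T lam =
    Σ (Fin n → Carrier) λ x →
      (∃ λ i → i ∈ V × ¬ (x i ≈ 0#)) ×
      (∀ i → i ∈ V →
        sumL (tuplesIn (pred k) V) (λ t → T i t * prodV t x) ≈ lam * pow (x i) (pred k))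

  EigOf : ∀ {k n} → KGraph k n → Weighting n → Carrier → Carrier → Set (c ⊔ ℓ)
  EigOf {k} H w inv lam = IsEigenvalue k (V H) (adjTensor k (E H) w inv) lam

  EigOfDel : ∀ {k n} → KGraph k n → Subset n → Weighting n → Carrier → Carrier → Set (c ⊔ ℓ)
  EigOfDel {k} H e w inv lam =
    IsEigenvalue k (verticesDel H e) (adjTensor k (edgesDel H e) w inv) lam

{-# OPTIONS --safe #-}
-- Extend an eigenvector x of A(H ∖ e) by zero to the deleted vertices; these lie in e and
-- meet no other edge. At a surviving vertex, tuples leaving V(H ∖ e) contribute zero, and
-- the remaining tuples see the same tensor entries, since the only edge that differs, e,
-- contains a deleted vertex. At a deleted vertex i every nonzero entry is either diagonal,
-- carrying the factor x i = 0, or comes from e, whose other degree-one vertex also carries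
-- a zero coordinate; so that equation reads 0 = λ · 0.
module Submission where

open import Defs
open import Data.Bool using (Bool; true; false; _∧_; not)
open import Data.Bool.Properties using (∧-identityʳ; ∧-zeroʳ; ∧-conicalˡ)
open import Data.Empty using (⊥-elim)
open import Data.Fin using (Fin)
open import Data.Fin.Properties using () renaming (_≟_ to _≟ᶠ_)
open import Data.Fin.Subset using (Subset; _∈_; _∉_; ⁅_⁆; _⊆_)
open import Data.Fin.Subset.Properties using (_∈?_; x∈p∪q⁻; x∈p∪q⁺; x∈⁅x⁆; x∈⁅y⁆⇒x≡y; ∉⊥)
open import Data.List using (List; []; _∷_; filterᵇ; length)
open import Data.List.Membership.Propositional using () renaming (_∈_ to _∈ᴸ_)
open import Data.List.Relation.Unary.Any using (here; there)
open import Data.Nat using (ℕ; suc; _≤_; _<_; _∸_; _!; _≡ᵇ_; s≤s; z≤n)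
open import Data.Nat.Properties using (m≤n⇒m≤1+n; m<n⇒m<1+n; n<1⇒n≡0)
open import Data.Product using (∃; ∃₂; _×_; _,_; proj₁; proj₂)
open import Data.Sum using (_⊎_; inj₁; inj₂)
open import Data.Vec using (Vec; []; _∷_; lookup)
open import Data.Vec.Properties using (lookup∘tabulate; []=⇒lookup; lookup⇒[]=)
open import Relation.Nullary using (Dec; yes; no)
open import Relation.Nullary.Decidable using (⌊_⌋; dec-true; isYes≗does)
open import Relation.Binary.PropositionalEquality
  using (_≡_; _≢_; refl; sym; trans; cong; cong₂; subst; module ≡-Reasoning)
open import Function using (_∘_; case_of_)
open import Algebra.Bundles using (CommutativeRing)

⌊⌋≡true : ∀ {p} {P : Set p} (P? : Dec P) → P → ⌊ P? ⌋ ≡ true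
⌊⌋≡true P? p = trans (isYes≗does P?) (dec-true P? p)

module _ {n : ℕ} where

  ∈-setOf⁻ : ∀ {p} {j} i (t : Vec (Fin n) p) → j ∈ setOf (i ∷ t) → j ≡ i ⊎ j ∈ setOf t
  ∈-setOf⁻ i t j∈ with x∈p∪q⁻ ⁅ i ⁆ (setOf t) j∈
  ... | inj₁ j∈⁅i⁆ = inj₁ (x∈⁅y⁆⇒x≡y i j∈⁅i⁆)
  ... | inj₂ j∈t = inj₂ j∈t

  ∈-setOf-head : ∀ {p} i (t : Vec (Fin n) p) → i ∈ setOf (i ∷ t)
  ∈-setOf-head i t = x∈p∪q⁺ (inj₁ (x∈⁅x⁆ i))

  ∈-setOf-tail : ∀ {p} {j} i (t : Vec (Fin n) p) → j ∈ setOf t → j ∈ setOf (i ∷ t)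
  ∈-setOf-tail i t j∈t = x∈p∪q⁺ (inj₂ j∈t)

  ∈-setOf-tail⁻ : ∀ {p} {j} i (t : Vec (Fin n) p) → j ∈ setOf (i ∷ t) → j ≢ i → j ∈ setOf t
  ∈-setOf-tail⁻ i t j∈ j≢i with ∈-setOf⁻ i t j∈
  ... | inj₁ j≡i = ⊥-elim (j≢i j≡i)
  ... | inj₂ j∈t = j∈t

  allIn⇒setOf⊆ : ∀ {p} (V : Subset n) (t : Vec (Fin n) p) → allIn V t ≡ true → setOf t ⊆ V
  allIn⇒setOf⊆ V [] _ j∈ = ⊥-elim (∉⊥ j∈)
  allIn⇒setOf⊆ V (i ∷ t) all j∈ with i ∈? V | ∈-setOf⁻ i t j∈
  ... | yes i∈V | inj₁ refl = i∈V
  ... | yes _ | inj₂ j∈t = allIn⇒setOf⊆ V t all j∈t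

  allIn-false⇒∉ : ∀ {p} (V : Subset n) (t : Vec (Fin n) p) → allIn V t ≡ false →
                  ∃ λ j → j ∈ setOf t × j ∉ V
  allIn-false⇒∉ V (i ∷ t) none with i ∈? V
  ... | no i∉V = i , ∈-setOf-head i t , i∉V
  ... | yes _ with allIn-false⇒∉ V t none
  ...   | j , j∈t , j∉V = j , ∈-setOf-tail i t j∈t , j∉V

  allIn-mono : ∀ {p} {V W : Subset n} → V ⊆ W → (t : Vec (Fin n) p) →
               allIn V t ≡ true → allIn W t ≡ true
  allIn-mono V⊆W [] _ = refl
  allIn-mono {V = V} {W} V⊆W (i ∷ t) all with i ∈? V | i ∈? W
  ... | yes _ | yes _ = allIn-mono V⊆W t all
  ... | yes i∈V | no i∉W = ⊥-elim (i∉W (V⊆W i∈V))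

  allEq⇒∈ : ∀ {p} i j (t : Vec (Fin n) p) → allEq i (j ∷ t) ≡ true → i ∈ setOf (j ∷ t)
  allEq⇒∈ i j t eq with i ≟ᶠ j
  ... | yes refl = ∈-setOf-head i t

  ∈ᴸ?⇒∈ᴸ : ∀ (s : Subset n) E → (s ∈ᴸ? E) ≡ true → s ∈ᴸ E
  ∈ᴸ?⇒∈ᴸ s (f ∷ E) eq with s ≟ˢ f
  ... | yes refl = here refl
  ... | no _ = there (∈ᴸ?⇒∈ᴸ s E eq)

  dropEdge : Subset n → List (Subset n) → List (Subset n)
  dropEdge e = filterᵇ (λ f → not ⌊ f ≟ˢ e ⌋)

  ∈ᴸ?-dropEdge : ∀ {s e : Subset n} E → s ≢ e → (s ∈ᴸ? dropEdge e E) ≡ (s ∈ᴸ? E)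
  ∈ᴸ?-dropEdge [] _ = refl
  ∈ᴸ?-dropEdge {s} {e} (f ∷ E) s≢e with f ≟ˢ e
  ... | yes refl with s ≟ˢ f
  ...   | yes refl = ⊥-elim (s≢e refl)
  ...   | no _ = ∈ᴸ?-dropEdge E s≢e
  ∈ᴸ?-dropEdge {s} (f ∷ E) s≢e | no _ with s ≟ˢ f
  ...   | yes _ = refl
  ...   | no _ = ∈ᴸ?-dropEdge E s≢e

  degIn≡0⇒∉ : ∀ {i} {f : Subset n} L → degIn L i ≡ 0 → f ∈ᴸ L → i ∉ f
  degIn≡0⇒∉ {i} (g ∷ L) d f∈ with i ∈? g
  degIn≡0⇒∉ (g ∷ L) () f∈ | yes _
  degIn≡0⇒∉ (g ∷ L) d (here refl) | no i∉g = i∉g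
  degIn≡0⇒∉ (g ∷ L) d (there f∈) | no _ = degIn≡0⇒∉ L d f∈

module _ {a} {A : Set a} (p q : A → Bool) where

  length-filterᵇ-filterᵇ : ∀ L → length (filterᵇ p (filterᵇ q L)) ≤ length (filterᵇ p L)
  length-filterᵇ-filterᵇ [] = z≤n
  length-filterᵇ-filterᵇ (x ∷ L) with q x
  ... | true with p x
  ...   | true = s≤s (length-filterᵇ-filterᵇ L)
  ...   | false = length-filterᵇ-filterᵇ L
  length-filterᵇ-filterᵇ (x ∷ L) | false with p x
  ...   | true = m≤n⇒m≤1+n (length-filterᵇ-filterᵇ L)
  ...   | false = length-filterᵇ-filterᵇ L

  length-filterᵇ-filterᵇ< : ∀ {x} L → x ∈ᴸ L → p x ≡ true → q x ≡ false →
                           length (filterᵇ p (filterᵇ q L)) < length (filterᵇ p L)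
  length-filterᵇ-filterᵇ< (x ∷ L) (here refl) px qx rewrite qx | px =
    s≤s (length-filterᵇ-filterᵇ L)
  length-filterᵇ-filterᵇ< (y ∷ L) (there x∈L) px qx with q y
  ... | true with p y
  ...   | true = s≤s (length-filterᵇ-filterᵇ< L x∈L px qx)
  ...   | false = length-filterᵇ-filterᵇ< L x∈L px qx
  length-filterᵇ-filterᵇ< (y ∷ L) (there x∈L) px qx | false with p y
  ...   | true = m<n⇒m<1+n (length-filterᵇ-filterᵇ< L x∈L px qx)
  ...   | false = length-filterᵇ-filterᵇ< L x∈L px qx

module _ {n : ℕ} {e : Subset n} where

  degIn-dropEdge< : ∀ {w} E → e ∈ᴸ E → w ∈ e → degIn (dropEdge e E) w < degIn E w
  degIn-dropEdge< {w} E e∈E w∈e =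
    length-filterᵇ-filterᵇ< (λ f → ⌊ w ∈? f ⌋) (λ f → not ⌊ f ≟ˢ e ⌋) E e∈E
      (⌊⌋≡true (w ∈? e) w∈e) (cong not (⌊⌋≡true (e ≟ˢ e) refl))

  ∈ᴸ-dropEdge : ∀ {f} E → f ∈ᴸ E → f ≢ e → f ∈ᴸ dropEdge e E
  ∈ᴸ-dropEdge (g ∷ E) f∈ f≢e with g ≟ˢ e | f∈
  ... | yes refl | here refl = ⊥-elim (f≢e refl)
  ... | yes _ | there f∈E = ∈ᴸ-dropEdge E f∈E f≢e
  ... | no _ | here refl = here refl
  ... | no _ | there f∈E = there (∈ᴸ-dropEdge E f∈E f≢e)

module Deletion {k n} (H : KGraph k n) (e : Subset n) where

  lookup-verticesDel : ∀ v → lookup (verticesDel H e) v ≡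
    lookup (V H) v ∧ not (⌊ v ∈? e ⌋ ∧ (degIn (edgesDel H e) v ≡ᵇ 0))
  lookup-verticesDel v = lookup∘tabulate _ v

  verticesDel⊆V : verticesDel H e ⊆ V H
  verticesDel⊆V {v} v∈ =
    lookup⇒[]= v (V H) (∧-conicalˡ _ _ (trans (sym (lookup-verticesDel v)) ([]=⇒lookup v∈)))

  ∉-verticesDel : ∀ {v} → v ∈ e → degIn (edgesDel H e) v ≡ 0 → v ∉ verticesDel H e
  ∉-verticesDel {v} v∈e d v∈ = true≢false (begin
    true                                ≡⟨ sym ([]=⇒lookup v∈) ⟩
    lookup (verticesDel H e) v          ≡⟨ lookup-verticesDel v ⟩
    lookup (V H) v ∧ not (⌊ v ∈? e ⌋ ∧ (degIn (edgesDel H e) v ≡ᵇ 0))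
      ≡⟨ cong₂ (λ a d′ → lookup (V H) v ∧ not (a ∧ (d′ ≡ᵇ 0))) (⌊⌋≡true (v ∈? e) v∈e) d ⟩
    lookup (V H) v ∧ false              ≡⟨ ∧-zeroʳ _ ⟩
    false                               ∎)
    where
    open ≡-Reasoning
    true≢false : true ≢ false
    true≢false ()

  ∉-verticesDel⁻ : ∀ {v} → v ∈ V H → v ∉ verticesDel H e →
                   v ∈ e × degIn (edgesDel H e) v ≡ 0
  ∉-verticesDel⁻ {v} v∈V v∉ with v ∈? e | degIn (edgesDel H e) v | lookup-verticesDel v
  ... | yes v∈e | 0 | _ = v∈e , refl
  ... | yes _ | suc _ | eq =
    ⊥-elim (v∉ (lookup⇒[]= v _ (trans eq (trans (∧-identityʳ _) ([]=⇒lookup v∈V)))))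
  ... | no _ | _ | eq =
    ⊥-elim (v∉ (lookup⇒[]= v _ (trans eq (trans (∧-identityʳ _) ([]=⇒lookup v∈V)))))

  degree-one⇒∉-verticesDel : ∀ {u} → e ∈ᴸ E H → u ∈ e → degree H u ≡ 1 → u ∉ verticesDel H e
  degree-one⇒∉-verticesDel e∈E u∈e du = ∉-verticesDel u∈e
    (n<1⇒n≡0 (subst (degIn (edgesDel H e) _ <_) du (degIn-dropEdge< (E H) e∈E u∈e)))

  ∉-verticesDel⇒edge≡e : ∀ {i f} → i ∈ V H → i ∉ verticesDel H e → f ∈ᴸ E H → i ∈ f → f ≡ e
  ∉-verticesDel⇒edge≡e {f = f} i∈V i∉ f∈E i∈f with f ≟ˢ e
  ... | yes f≡e = f≡e
  ... | no f≢e = ⊥-elim (degIn≡0⇒∉ (edgesDel H e) (proj₂ (∉-verticesDel⁻ i∈V i∉))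
                           (∈ᴸ-dropEdge (E H) f∈E f≢e) i∈f)

module Sums {c ℓ} (R : CommutativeRing c ℓ) where
  open CommutativeRing R renaming (refl to ≈-refl; sym to ≈-sym; trans to ≈-trans)

  sumL-zero : ∀ {a} {A : Set a} (L : List A) (f : A → Carrier) →
              (∀ t → f t ≈ 0#) → sumL R L f ≈ 0#
  sumL-zero [] f _ = ≈-refl
  sumL-zero (t ∷ L) f f≈0 = ≈-trans (+-cong (f≈0 t) (sumL-zero L f f≈0)) (+-identityˡ 0#)

  sumL-filterᵇ-restrict : ∀ {a} {A : Set a} (L : List A) {p q : A → Bool} {f g : A → Carrier} →
    (∀ t → q t ≡ true → p t ≡ true × f t ≈ g t) →
    (∀ t → p t ≡ true → q t ≡ false → f t ≈ 0#) →
    sumL R (filterᵇ p L) f ≈ sumL R (filterᵇ q L) g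
  sumL-filterᵇ-restrict [] _ _ = ≈-refl
  sumL-filterᵇ-restrict (t ∷ L) {p} {q} q⇒p∧f≈g p∧¬q⇒f≈0 with p t in pt | q t in qt
  ... | true | true = +-cong (proj₂ (q⇒p∧f≈g t qt)) (sumL-filterᵇ-restrict L q⇒p∧f≈g p∧¬q⇒f≈0)
  ... | true | false = ≈-trans (+-cong (p∧¬q⇒f≈0 t pt qt) (sumL-filterᵇ-restrict L q⇒p∧f≈g p∧¬q⇒f≈0))
                               (+-identityˡ _)
  ... | false | true with () ← trans (sym pt) (proj₁ (q⇒p∧f≈g t qt))
  ... | false | false = sumL-filterᵇ-restrict L q⇒p∧f≈g p∧¬q⇒f≈0

  prodV-≈0 : ∀ {n p} (t : Vec (Fin n) p) {x : Fin n → Carrier} {j} →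
             j ∈ setOf t → x j ≈ 0# → prodV R t x ≈ 0#
  prodV-≈0 [] j∈ _ = ⊥-elim (∉⊥ j∈)
  prodV-≈0 (i ∷ t) j∈ xj≈0 with ∈-setOf⁻ i t j∈
  ... | inj₁ refl = ≈-trans (*-congʳ xj≈0) (zeroˡ _)
  ... | inj₂ j∈t = ≈-trans (*-congˡ (prodV-≈0 t j∈t xj≈0)) (zeroʳ _)

  prodV-cong : ∀ {n p} (t : Vec (Fin n) p) {x y : Fin n → Carrier} →
               (∀ {j} → j ∈ setOf t → x j ≈ y j) → prodV R t x ≈ prodV R t y
  prodV-cong [] _ = ≈-refl
  prodV-cong (i ∷ t) x≈y = *-cong (x≈y (∈-setOf-head i t)) (prodV-cong t (x≈y ∘ ∈-setOf-tail i t))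

  zeroOutside : ∀ {n} → Subset n → (Fin n → Carrier) → Fin n → Carrier
  zeroOutside V x j with j ∈? V
  ... | yes _ = x j
  ... | no _ = 0#

  zeroOutside-∈ : ∀ {n} {V : Subset n} {x j} → j ∈ V → zeroOutside V x j ≡ x j
  zeroOutside-∈ {V = V} {j = j} j∈V with j ∈? V
  ... | yes _ = refl
  ... | no j∉V = ⊥-elim (j∉V j∈V)

  zeroOutside-∉ : ∀ {n} {V : Subset n} {x j} → j ∉ V → zeroOutside V x j ≈ 0#
  zeroOutside-∉ {V = V} {j = j} j∉V with j ∈? V
  ... | yes j∈V = ⊥-elim (j∉V j∈V)
  ... | no _ = ≈-refl

module Extension {c ℓ} (R : CommutativeRing c ℓ) {m n} (H : KGraph (suc (suc m)) n)
  (w : Weighting R n) (inv : CommutativeRing.Carrier R)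
  {e : Subset n} (e∈E : e ∈ᴸ E H) {u v : Fin n} (u≢v : u ≢ v) (u∈e : u ∈ e) (v∈e : v ∈ e)
  (du : degree H u ≡ 1) (dv : degree H v ≡ 1) where

  open CommutativeRing R renaming (refl to ≈-refl; sym to ≈-sym; trans to ≈-trans)
  open Sums R
  open Deletion H e
  open import Relation.Binary.Reasoning.Setoid setoid

  V′ : Subset n
  V′ = verticesDel H e

  A A′ : Tensor R (suc (suc m)) n
  A = adjTensor R (suc (suc m)) (E H) w inv
  A′ = adjTensor R (suc (suc m)) (edgesDel H e) w inv

  u∉V′ : u ∉ V′
  u∉V′ = degree-one⇒∉-verticesDel e∈E u∈e du

  surviving-tuple≢e : ∀ {p} {i} (t : Vec (Fin n) p) → i ∈ V′ → allIn V′ t ≡ true → setOf (i ∷ t) ≢ e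
  surviving-tuple≢e {i = i} t i∈V′ t⊆V′ eq with ∈-setOf⁻ i t (subst (u ∈_) (sym eq) u∈e)
  ... | inj₁ refl = u∉V′ i∈V′
  ... | inj₂ u∈t = u∉V′ (allIn⇒setOf⊆ V′ t t⊆V′ u∈t)

  A≡A′ : ∀ {i} (t : Vec (Fin n) (suc m)) → i ∈ V′ → allIn V′ t ≡ true → A i t ≡ A′ i t
  A≡A′ {i} t i∈V′ t⊆V′ with allEq i t
  ... | true = refl
  ... | false rewrite ∈ᴸ?-dropEdge {e = e} (E H) (surviving-tuple≢e t i∈V′ t⊆V′) = refl

  module _ (x : Fin n → Carrier) where

    x′ : Fin n → Carrier
    x′ = zeroOutside V′ x

    edge-e-meets-zero : ∀ i (t : Vec (Fin n) (suc m)) → setOf (i ∷ t) ≡ e →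
                        ∃ λ j → j ∈ setOf t × x′ j ≈ 0#
    edge-e-meets-zero i t eq with u ≟ᶠ i
    ... | no u≢i = u , ∈-setOf-tail⁻ i t (subst (u ∈_) (sym eq) u∈e) u≢i , zeroOutside-∉ u∉V′
    ... | yes refl = v , ∈-setOf-tail⁻ i t (subst (v ∈_) (sym eq) v∈e) (u≢v ∘ sym)
                       , zeroOutside-∉ (degree-one⇒∉-verticesDel e∈E v∈e dv)

    term-at-deleted≈0 : ∀ {i} → i ∈ V H → i ∉ V′ → (t : Vec (Fin n) (suc m)) →
                        A i t * prodV R t x′ ≈ 0#
    term-at-deleted≈0 {i} i∈V i∉V′ (j ∷ t) with allEq i (j ∷ t) in diagonal
    ... | true = ≈-trans (*-congˡ (prodV-≈0 (j ∷ t) (allEq⇒∈ i j t diagonal) (zeroOutside-∉ i∉V′)))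
                         (zeroʳ _)
    ... | false with setOf (i ∷ j ∷ t) ∈ᴸ? E H in edge
    ...   | false = zeroˡ _
    ...   | true with edge-e-meets-zero i (j ∷ t) (∉-verticesDel⇒edge≡e i∈V i∉V′
                                                    (∈ᴸ?⇒∈ᴸ _ (E H) edge) (∈-setOf-head i (j ∷ t)))
    ...     | z , z∈t , x′z≈0 = ≈-trans (*-congˡ (prodV-≈0 (j ∷ t) z∈t x′z≈0)) (zeroʳ _)

    equation-at-surviving : ∀ {lam i} → i ∈ V′ →
      sumL R (tuplesIn (suc m) V′) (λ t → A′ i t * prodV R t x) ≈ lam * pow R (x i) (suc m) →
      sumL R (tuplesIn (suc m) (V H)) (λ t → A i t * prodV R t x′) ≈ lam * pow R (x′ i) (suc m)
    equation-at-surviving {lam} {i} i∈V′ equation = begin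
      sumL R (tuplesIn (suc m) (V H)) (λ t → A i t * prodV R t x′)
        ≈⟨ sumL-filterᵇ-restrict (allVecs (suc m) n) inside escaping ⟩
      sumL R (tuplesIn (suc m) V′) (λ t → A′ i t * prodV R t x)
        ≈⟨ equation ⟩
      lam * pow R (x i) (suc m)
        ≡⟨ cong (λ a → lam * pow R a (suc m)) (sym (zeroOutside-∈ i∈V′)) ⟩
      lam * pow R (x′ i) (suc m) ∎
      where
      inside : ∀ t → allIn V′ t ≡ true →
               allIn (V H) t ≡ true × A i t * prodV R t x′ ≈ A′ i t * prodV R t x
      inside t t⊆V′ =
        allIn-mono verticesDel⊆V t t⊆V′ ,
        *-cong (reflexive (A≡A′ t i∈V′ t⊆V′))
               (prodV-cong t (reflexive ∘ zeroOutside-∈ ∘ allIn⇒setOf⊆ V′ t t⊆V′))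
      escaping : ∀ t → allIn (V H) t ≡ true → allIn V′ t ≡ false → A i t * prodV R t x′ ≈ 0#
      escaping t _ t⊈V′ with allIn-false⇒∉ V′ t t⊈V′
      ... | j , j∈t , j∉V′ = ≈-trans (*-congˡ (prodV-≈0 t j∈t (zeroOutside-∉ j∉V′))) (zeroʳ _)

    equation-at-deleted : ∀ {lam i} → i ∈ V H → i ∉ V′ →
      sumL R (tuplesIn (suc m) (V H)) (λ t → A i t * prodV R t x′) ≈ lam * pow R (x′ i) (suc m)
    equation-at-deleted {lam} {i} i∈V i∉V′ = begin
      sumL R (tuplesIn (suc m) (V H)) (λ t → A i t * prodV R t x′)
        ≈⟨ sumL-zero (tuplesIn (suc m) (V H)) _ (term-at-deleted≈0 i∈V i∉V′) ⟩
      0#                                  ≈⟨ ≈-sym (zeroʳ lam) ⟩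
      lam * 0#                            ≈⟨ *-congˡ (≈-sym (zeroˡ _)) ⟩
      lam * (0# * pow R (x′ i) m)         ≈⟨ *-congˡ (*-congʳ (≈-sym (zeroOutside-∉ i∉V′))) ⟩
      lam * pow R (x′ i) (suc m)          ∎

  EigOfDel⇒EigOf : ∀ {lam} → EigOfDel R H e w inv lam → EigOf R H w inv lam
  EigOfDel⇒EigOf {lam} (x , (i₀ , i₀∈V′ , xi₀≉0) , equations) =
    x′ x , (i₀ , verticesDel⊆V i₀∈V′ , xi₀≉0 ∘ subst (_≈ 0#) (zeroOutside-∈ i₀∈V′)) , equation
    where
    equation : ∀ i → i ∈ V H →
      sumL R (tuplesIn (suc m) (V H)) (λ t → A i t * prodV R t (x′ x)) ≈ lam * pow R (x′ x i) (suc m)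
    equation i i∈V = case i ∈? V′ of λ where
      (yes i∈V′) → equation-at-surviving x i∈V′ (equations i i∈V′)
      (no i∉V′) → equation-at-deleted x i∈V i∉V′

lemma2p2 : ∀ {c ℓ} (R : CommutativeRing c ℓ) →
    let open CommutativeRing R in
    (k n : ℕ) → 3 ≤ k → (H : KGraph k n) → (w : Weighting R n) →
    (inv : Carrier) → inv * natR R ((k ∸ 1) !) ≈ 1# →
    (e : Subset n) → e ∈ᴸ E H →
    (∃₂ λ u v → u ≢ v × u ∈ e × v ∈ e × degree H u ≡ 1 × degree H v ≡ 1) →
    (lam : Carrier) → EigOfDel R H e w inv lam → EigOf R H w inv lam
lemma2p2 R (suc (suc m)) n (s≤s (s≤s _)) H w inv _ e e∈E (u , v , u≢v , u∈e , v∈e , du , dv) lam =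
  Extension.EigOfDel⇒EigOf R H w inv e∈E u≢v u∈e v∈e du dv
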